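{- Let $k\ge 3$ and $m\ge 2$ be integers and let $\mathcal{T}$ be a $k$-uniform supertree on $n$ vertices with $m=\frac{n-1}{k-1}$ edges. Then: (a) $h(\mathcal{T})\ge 2(m-1)\log 2$, with equality if and only if the maximum vertex degree of $\mathcal{T}$ is $2$; (b) $h(\mathcal{T})\le m\log m$, with equality if and only if $\mathcal{T}\cong S^k_{m+1}$.
   Context: All logarithms are to base $2$. A $k$-uniform hypergraph consists of a finite vertex set and a set of distinct edges, each a $k$-element subset of the vertex set; the degree $d_v$ of a vertex is the number of edges containing it. A walk is a sequence $v_0e_1v_1\cdots e_lv_l$ with $\{v_{i-1},v_i\}\subseteq e_i$; connected means any two vertices are joined by a walk; a cycle is a walk with $l\ge 2$, $v_0=v_l$ and no other repeated vertices or edges. A supertree is a connected hypergraph with no cycle; equivalently, a connected $k$-uniform hypergraph with $n$ vertices and $m$ edges satisfying $m(k-1)=n-1$. The hyperstar $S^k_{m+1}$ is the $k$-uniform hypergraph with $m$ edges that all contain one common vertex and are otherwise pairwise disjoint. For a hypergraph with vertex degrees $d_1,\dots,d_n$, $h(\mathcal{H})=\sum_{i=1}^n d_i\log d_i$. -}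

module Defs where

open import Data.Nat using (ℕ; zero; suc; _+_; _*_; _^_; _≤_)
open import Data.Fin using (Fin; zero; suc; inject₁; fromℕ)
open import Data.Fin.Subset using (Subset; _∈_; ∣_∣)
open import Data.Fin.Subset.Properties using (_∈?_)
open import Data.List using (List; length; filter; map; allFin; lookup)
open import Data.Nat.ListAction using (product)
open import Data.Empty using (⊥)
open import Data.List.Relation.Unary.All using (All)
open import Data.List.Relation.Unary.Unique.Propositional using (Unique)
open import Data.Product using (Σ; _×_; ∃; ∃-syntax)
open import Relation.Binary.PropositionalEquality using (_≡_; _≢_)
open import Function.Definitions using (Injective)

record Hypergraph : Set where
  field
    n        : ℕ
    edges    : List (Subset n)
    distinct : Unique edges
open Hypergraph public

#E : Hypergraph → ℕ
#E H = length (edges H)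

edge : (H : Hypergraph) → Fin (#E H) → Subset (n H)
edge H i = lookup (edges H) i

Uniform : ℕ → Hypergraph → Set
Uniform k H = All (λ e → ∣ e ∣ ≡ k) (edges H)

deg : (H : Hypergraph) → Fin (n H) → ℕ
deg H v = length (filter (v ∈?_) (edges H))

-- A walk v_0 e_1 v_1 ... e_l v_l, with {v_{i-1}, v_i} ⊆ e_i.
-- vs i = v_i (i = 0..l), es i = e_{i+1} (given as an edge index, i = 0..l-1).
record Walk (H : Hypergraph) : Set where
  field
    len : ℕ
    vs  : Fin (suc len) → Fin (n H)
    es  : Fin len → Fin (#E H)
    ok  : ∀ (i : Fin len) → (vs (inject₁ i) ∈ edge H (es i)) × (vs (suc i) ∈ edge H (es i))
open Walk public

start end : ∀ {H} → Walk H → Fin (n H)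
start w = vs w zero
end   w = vs w (fromℕ (len w))

Connected : Hypergraph → Set
Connected H = ∀ (u v : Fin (n H)) → Σ (Walk H) (λ w → (start w ≡ u) × (end w ≡ v))

IsCycle : ∀ {H} → Walk H → Set
IsCycle w = (2 ≤ len w) × (start w ≡ end w)
          × Injective _≡_ _≡_ (λ i → vs w (inject₁ i))
          × Injective _≡_ _≡_ (es w)

Acyclic : Hypergraph → Set
Acyclic H = (w : Walk H) → IsCycle w → ⊥

IsSupertree : Hypergraph → Set
IsSupertree H = Connected H × Acyclic H

-- 2^{h(H)} = ∏_v d_v^{d_v}   (with 0^0 = 1, matching 0 log 0 = 0)
expH : Hypergraph → ℕ
expH H = product (map (λ v → deg H v ^ deg H v) (allFin (n H)))

MaxDegreeIs : Hypergraph → ℕ → Set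
MaxDegreeIs H d = (∀ v → deg H v ≤ d) × (∃[ v ] deg H v ≡ d)

-- For a k-uniform H with m edges and no isolated vertices
-- (e.g. connected, m ≥ 1) this is exactly H ≅ S^k_{m+1}.
IsHyperstar : Hypergraph → Set
IsHyperstar H = Σ (Fin (n H)) λ c →
  (∀ i → c ∈ edge H i) ×
  (∀ i j → i ≢ j → ∀ v → v ∈ edge H i → v ∈ edge H j → v ≡ c)

{-# OPTIONS --safe #-}
module Submission where

-- Let d be the degree sequence of T and S = ∑ᵥ (dᵥ − 1); then 2^h(T) = ∏ᵥ dᵥ^dᵥ.
-- Counting incidences gives ∑ᵥ dᵥ = m k, and a supertree has n = 1 + m (k − 1) vertices:
-- adding the edges one by one to a labelling of the components, acyclicity forces every
-- new edge to meet k distinct components, which it merges into one.  As all degrees are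
-- positive, S = m k − n = m − 1.
-- (a) d^d ≥ 4^(d − 1), with equality iff d ≤ 2; multiply over the vertices.
-- (b) Replacing two degrees 1 + a and 1 + b by the single degree 1 + a + b keeps S and does
-- not decrease ∏ d^d (Bernoulli's inequality), strictly if a, b ≥ 1.  Hence ∏ d^d ≤ (1 + S)^(1 + S),
-- with equality iff at most one vertex has degree ≥ 2; that vertex then has degree S + 1 = m,
-- so it lies in every edge and the edges meet nowhere else.

open import Algebra.Definitions using (IdempotentFun)
open import Data.Bool using (if_then_else_)
open import Data.Empty using (⊥-elim)
open import Data.Fin using (Fin; zero; suc; punchIn; _≟_; inject₁; fromℕ; fromℕ<; toℕ)
open import Data.Fin.Properties using (punchInᵢ≢i)
import Data.Fin.Properties as Finₚ
open import Data.Fin.Subset using (Subset; _∈_; ∣_∣; inside; outside)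
open import Data.Fin.Subset.Properties using (_∈?_)
open import Data.List using (List; []; _∷_; _++_; length; filter; tabulate; map; allFin; lookup)
open import Data.List.Properties using (map-tabulate; tabulate-lookup; length-map)
import Data.List.Membership.DecPropositional as DecMembership
open import Data.List.Membership.Propositional using (find) renaming (_∈_ to _∈ₗ_; _∉_ to _∉ₗ_)
open import Data.List.Membership.Propositional.Properties
  using (∈-lookup; ∈-map⁻; ∈-filter⁺; ∈-filter⁻; ∈-allFin)
open import Data.List.Relation.Binary.Subset.Propositional using (_⊆_)
open import Data.List.Relation.Binary.Subset.Propositional.Properties using (⊆-refl; ⊆-trans; xs⊆x∷xs; ∷⁺ʳ)
import Data.List.Relation.Unary.All as All
open All using (All; []; _∷_)
import Data.List.Relation.Unary.All.Properties as Allₚ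
open import Data.List.Relation.Unary.AllPairs using ([]; _∷_)
open import Data.List.Relation.Unary.Any as Any using (Any; here; there; any?)
import Data.List.Relation.Unary.Any.Properties as Anyₚ
open import Data.List.Relation.Unary.Unique.Propositional using (Unique)
import Data.List.Relation.Unary.Unique.Propositional.Properties as Uniqueₚ
open import Data.Nat
  using (ℕ; zero; suc; _+_; _*_; _∸_; _^_; _≤_; _<_; _≤?_; z≤n; s≤s; s≤s⁻¹; >-nonZero)
open import Data.Nat.ListAction using (product)
open import Data.Nat.Properties hiding (_≟_)
open import Data.Nat.Tactic.RingSolver using (solve-∀)
open import Data.Product using (Σ; ∃; ∃₂; _×_; _,_; proj₁; proj₂)
open import Data.Sum using (_⊎_; inj₁; inj₂)
open import Data.Unit using (⊤; tt)
open import Data.Vec using ([]; _∷_)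
open import Data.Vec.Functional using (Vector)
open import Function using (_∘_; flip)
open import Function.Bundles using (_⇔_; mk⇔; Equivalence)
open import Function.Definitions using (Injective)
open import Function.Properties.Equivalence using () renaming (trans to ⇔-trans)
open import Level using (Level)
open import Relation.Binary.PropositionalEquality
open import Relation.Nullary using (Dec; does; yes; no; ¬_; contradiction)
open import Relation.Unary using (Pred; Decidable)

open import Algebra.Properties.CommutativeMonoid.Sum +-0-commutativeMonoid
  using (sum; sum-syntax; sum-cong-≗; sum-remove; sum-replicate-zero; ∑-distrib-+; ∑-comm)
open import Algebra.Properties.CommutativeMonoid.Sum *-1-commutativeMonoid
  using () renaming (sum to ∏; sum-cong-≗ to ∏-cong; sum-replicate-zero to ∏-replicate-1)

open import Defs renaming (n to #V)

open module FinListMembership {n} = DecMembership (_≟_ {n}) using () renaming (_∈?_ to _∈ₗ?_)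

private
  variable
    n : ℕ

∑-const : ∀ n c → ∑[ i < n ] c ≡ n * c
∑-const zero    c = refl
∑-const (suc n) c = cong (c +_) (∑-const n c)

∑-zero : (f : Vector ℕ n) → (∀ i → f i ≡ 0) → sum f ≡ 0
∑-zero {n} f f≡0 = trans (sum-cong-≗ f≡0) (sum-replicate-zero n)

∑-single : (f : Vector ℕ n) (c : Fin n) → (∀ i → i ≢ c → f i ≡ 0) → sum f ≡ f c
∑-single {suc n} f c f≡0 = begin
  sum f                            ≡⟨ sum-remove f ⟩
  f c + ∑[ j < n ] f (punchIn c j) ≡⟨ cong (f c +_) (∑-zero _ (λ j → f≡0 _ (punchInᵢ≢i c j))) ⟩
  f c + 0                          ≡⟨ +-identityʳ (f c) ⟩
  f c                              ∎
  where open ≡-Reasoning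

term≤∑ : (f : Vector ℕ n) (i : Fin n) → f i ≤ sum f
term≤∑ f zero    = m≤m+n (f zero) _
term≤∑ f (suc i) = ≤-trans (term≤∑ (f ∘ suc) i) (m≤n+m _ (f zero))

∑-pos : (f : Vector ℕ n) → 1 ≤ sum f → ∃ λ i → 1 ≤ f i
∑-pos {suc n} f ∑f≥1 with f zero in f0≡
... | suc _ = zero , subst (1 ≤_) (sym f0≡) (s≤s z≤n)
... | zero  = let (i , fi≥1) = ∑-pos (f ∘ suc) ∑f≥1 in suc i , fi≥1

∑-pred : (f : Vector ℕ n) → (∀ i → 1 ≤ f i) → ∑[ i < n ] (f i ∸ 1) + n ≡ sum f
∑-pred {n} f f≥1 = begin
  ∑[ i < n ] (f i ∸ 1) + n            ≡⟨ cong (∑[ i < n ] (f i ∸ 1) +_) ∑1≡n ⟨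
  ∑[ i < n ] (f i ∸ 1) + ∑[ i < n ] 1 ≡⟨ ∑-distrib-+ (λ i → f i ∸ 1) (λ _ → 1) ⟨
  ∑[ i < n ] (f i ∸ 1 + 1)            ≡⟨ sum-cong-≗ (λ i → m∸n+n≡m (f≥1 i)) ⟩
  sum f                               ∎
  where
  open ≡-Reasoning
  ∑1≡n : ∑[ i < n ] 1 ≡ n
  ∑1≡n = trans (∑-const n 1) (*-identityʳ n)

-- Defined through does, so that 𝟙 also computes on decisions built with Dec.map′,
-- such as those of _∈?_ on subsets.
𝟙 : ∀ {p} {P : Set p} → Dec P → ℕ
𝟙 P? = if does P? then 1 else 0

𝟙-yes : ∀ {p} {P : Set p} (P? : Dec P) → P → 𝟙 P? ≡ 1
𝟙-yes (yes _) _ = refl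
𝟙-yes (no ¬p) p = contradiction p ¬p

𝟙-no : ∀ {p} {P : Set p} (P? : Dec P) → ¬ P → 𝟙 P? ≡ 0
𝟙-no (yes p) ¬p = contradiction p ¬p
𝟙-no (no _)  _  = refl

𝟙≥1⇒ : ∀ {p} {P : Set p} (P? : Dec P) → 1 ≤ 𝟙 P? → P
𝟙≥1⇒ (yes p) _ = p

𝟙-cong : ∀ {p q} {P : Set p} {Q : Set q} → (P → Q) → (Q → P) →
         (P? : Dec P) (Q? : Dec Q) → 𝟙 P? ≡ 𝟙 Q?
𝟙-cong P⇒Q Q⇒P (yes p) Q? = sym (𝟙-yes Q? (P⇒Q p))
𝟙-cong P⇒Q Q⇒P (no ¬p) Q? = sym (𝟙-no Q? (¬p ∘ Q⇒P))

count : ∀ {p} {P : Pred (Fin n) p} → Decidable P → ℕ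
count {n} P? = ∑[ i < n ] 𝟙 (P? i)

length-filter-tabulate : ∀ {a p} {A : Set a} {P : Pred A p} (P? : Decidable P) (f : Fin n → A) →
                         length (filter P? (tabulate f)) ≡ count (P? ∘ f)
length-filter-tabulate {zero}  P? f = refl
length-filter-tabulate {suc n} P? f with P? (f zero)
... | yes _ = cong suc (length-filter-tabulate P? (f ∘ suc))
... | no  _ = length-filter-tabulate P? (f ∘ suc)

module _ {p : Level} where

  count≤n : {P : Pred (Fin n) p} (P? : Decidable P) → count P? ≤ n
  count≤n {zero}  P? = z≤n
  count≤n {suc n} P? with P? zero
  ... | yes _ = s≤s (count≤n (P? ∘ suc))
  ... | no  _ = m≤n⇒m≤1+n (count≤n (P? ∘ suc))

  count≡n⇒all : {P : Pred (Fin n) p} (P? : Decidable P) → count P? ≡ n → ∀ i → P i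
  count≡n⇒all {suc n} P? count≡n i with P? zero | i
  ... | yes P0 | zero  = P0
  ... | yes _  | suc i = count≡n⇒all (P? ∘ suc) (suc-injective count≡n) i
  ... | no  _  | _     = contradiction (≤-reflexive (sym count≡n)) (<⇒≱ (s≤s (count≤n (P? ∘ suc))))

  count-full : {P : Pred (Fin n) p} (P? : Decidable P) → (∀ i → P i) → count P? ≡ n
  count-full {n} P? all = begin
    count P?     ≡⟨ sum-cong-≗ (λ i → 𝟙-yes (P? i) (all i)) ⟩
    ∑[ i < n ] 1 ≡⟨ ∑-const n 1 ⟩
    n * 1        ≡⟨ *-identityʳ n ⟩
    n            ∎
    where open ≡-Reasoning

  count≥1 : {P : Pred (Fin n) p} (P? : Decidable P) → ∀ {i} → P i → 1 ≤ count P?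
  count≥1 P? {i} Pi = subst (_≤ count P?) (𝟙-yes (P? i) Pi) (term≤∑ (𝟙 ∘ P?) i)

  count≥1⇒∃ : {P : Pred (Fin n) p} (P? : Decidable P) → 1 ≤ count P? → ∃ P
  count≥1⇒∃ P? count≥1 = let (i , 𝟙≥1) = ∑-pos (𝟙 ∘ P?) count≥1 in i , 𝟙≥1⇒ (P? i) 𝟙≥1

  count≥2 : {P : Pred (Fin n) p} (P? : Decidable P) → ∀ {i j} → i ≢ j → P i → P j → 2 ≤ count P?
  count≥2 P? {zero}  {zero}  i≢j _  _  = contradiction refl i≢j
  count≥2 P? {zero}  {suc j} _   Pi Pj =
    +-mono-≤ (≤-reflexive (sym (𝟙-yes (P? zero) Pi))) (count≥1 (P? ∘ suc) Pj)
  count≥2 P? {suc i} {zero}  _   Pi Pj =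
    +-mono-≤ (≤-reflexive (sym (𝟙-yes (P? zero) Pj))) (count≥1 (P? ∘ suc) Pi)
  count≥2 P? {suc i} {suc j} i≢j Pi Pj =
    ≤-trans (count≥2 (P? ∘ suc) (i≢j ∘ cong suc) Pi Pj) (m≤n+m _ (𝟙 (P? zero)))

  count≥2⇒∃₂ : {P : Pred (Fin n) p} (P? : Decidable P) → 2 ≤ count P? →
               ∃₂ λ i j → i ≢ j × P i × P j
  count≥2⇒∃₂ {suc n} P? count≥2 with P? zero
  ... | yes P0 = let (j , Pj) = count≥1⇒∃ (P? ∘ suc) (s≤s⁻¹ count≥2) in
                 zero , suc j , (λ ()) , P0 , Pj
  ... | no  _  = let (i , j , i≢j , Pi , Pj) = count≥2⇒∃₂ (P? ∘ suc) count≥2 in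
                 suc i , suc j , i≢j ∘ Finₚ.suc-injective , Pi , Pj

count-≡ : (x : Fin n) → count (_≟ x) ≡ 1
count-≡ x = trans (∑-single _ x (λ i i≢x → 𝟙-no (i ≟ x) i≢x)) (𝟙-yes (x ≟ x) refl)

count-∈ : (xs : List (Fin n)) → Unique xs → count (_∈ₗ? xs) ≡ length xs
count-∈ {n} []       _              = ∑-zero {n} _ (λ _ → refl)
count-∈ {n} (x ∷ xs) (x∉xs ∷ uniq) = begin
  count (_∈ₗ? x ∷ xs)                   ≡⟨ sum-cong-≗ split ⟩
  ∑[ v < n ] (𝟙 (v ≟ x) + 𝟙 (v ∈ₗ? xs)) ≡⟨ ∑-distrib-+ (𝟙 ∘ (_≟ x)) (𝟙 ∘ (_∈ₗ? xs)) ⟩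
  count (_≟ x) + count (_∈ₗ? xs)        ≡⟨ cong₂ _+_ (count-≡ x) (count-∈ xs uniq) ⟩
  suc (length xs)                       ∎
  where
  open ≡-Reasoning
  split : ∀ v → 𝟙 (v ∈ₗ? x ∷ xs) ≡ 𝟙 (v ≟ x) + 𝟙 (v ∈ₗ? xs)
  split v with v ≟ x | v ∈ₗ? xs
  ... | yes refl | yes v∈xs = contradiction refl (All.lookup x∉xs v∈xs)
  ... | yes _    | no  _    = refl
  ... | no  _    | yes _    = refl
  ... | no  _    | no  _    = refl

∉-swap : ∀ {a} {A : Set a} {x y : A} {ys} → x ∉ₗ ys → y ∉ₗ x ∷ ys → x ∉ₗ y ∷ ys
∉-swap x∉ys y∉x∷ys (here x≡y)  = y∉x∷ys (here (sym x≡y))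
∉-swap x∉ys y∉x∷ys (there x∈ys) = x∉ys x∈ys

Unique-map⁺ : ∀ {a b} {A : Set a} {B : Set b} (f : A → B) {xs : List A} →
              (∀ {x y} → x ∈ₗ xs → y ∈ₗ xs → f x ≡ f y → x ≡ y) →
              Unique xs → Unique (map f xs)
Unique-map⁺ f {[]}     inj []              = []
Unique-map⁺ f {x ∷ xs} inj (x∉xs ∷ uniq) =
  Allₚ.map⁺ (All.tabulate λ y∈xs fx≡fy → All.lookup x∉xs y∈xs (inj (here refl) (there y∈xs) fx≡fy))
  ∷
  Unique-map⁺ f (λ x∈ y∈ → inj (there x∈) (there y∈)) uniq

product-allFin : (f : Vector ℕ n) → product (map f (allFin n)) ≡ ∏ f
product-allFin {n} f = trans (cong product (map-tabulate (λ i → i) f)) (product-tabulate f)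
  where
  product-tabulate : ∀ {n} (f : Vector ℕ n) → product (tabulate f) ≡ ∏ f
  product-tabulate {zero}  f = refl
  product-tabulate {suc n} f = cong (f zero *_) (product-tabulate (f ∘ suc))

^-∑ : ∀ m (f : Vector ℕ n) → m ^ sum f ≡ ∏ (λ i → m ^ f i)
^-∑ {zero}  m f = refl
^-∑ {suc n} m f = trans (^-distribˡ-+-* m (f zero) (sum (f ∘ suc))) (cong (m ^ f zero *_) (^-∑ m (f ∘ suc)))

∏-mono-≤ : (f g : Vector ℕ n) → (∀ i → f i ≤ g i) → ∏ f ≤ ∏ g
∏-mono-≤ {zero}  f g f≤g = ≤-refl
∏-mono-≤ {suc n} f g f≤g = *-mono-≤ (f≤g zero) (∏-mono-≤ (f ∘ suc) (g ∘ suc) (f≤g ∘ suc))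

∏-pos : (f : Vector ℕ n) → (∀ i → 0 < f i) → 0 < ∏ f
∏-pos {n} f f>0 = subst (_≤ ∏ f) (∏-replicate-1 n) (∏-mono-≤ (λ _ → 1) f f>0)

*-mono-≤-equality : ∀ {a a′ b b′} → a ≤ a′ → b ≤ b′ → 0 < a → 0 < b →
                    a * b ≡ a′ * b′ → a ≡ a′ × b ≡ b′
*-mono-≤-equality {a} {a′} {b} {b′} a≤a′ b≤b′ a>0 b>0 ab≡a′b′ = a≡a′ , b≡b′
  where
  instance
    _ = >-nonZero a>0
    _ = >-nonZero (<-≤-trans b>0 b≤b′)
  a≡a′ : a ≡ a′
  a≡a′ = ≤-antisym a≤a′ (*-cancelʳ-≤ a′ a b′ (subst (_≤ a * b′) ab≡a′b′ (*-monoʳ-≤ a b≤b′)))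
  b≡b′ : b ≡ b′
  b≡b′ = *-cancelˡ-≡ b b′ a (trans ab≡a′b′ (cong (_* b′) (sym a≡a′)))

∏-mono-≤-equality : (f g : Vector ℕ n) → (∀ i → 0 < f i) → (∀ i → f i ≤ g i) →
                    ∏ f ≡ ∏ g → ∀ i → f i ≡ g i
∏-mono-≤-equality {suc n} f g f>0 f≤g ∏f≡∏g = λ where
    zero    → proj₁ head-and-tail
    (suc i) → ∏-mono-≤-equality (f ∘ suc) (g ∘ suc) (f>0 ∘ suc) (f≤g ∘ suc) (proj₂ head-and-tail) i
  where
  head-and-tail : f zero ≡ g zero × ∏ (f ∘ suc) ≡ ∏ (g ∘ suc)
  head-and-tail = *-mono-≤-equality (f≤g zero) (∏-mono-≤ (f ∘ suc) (g ∘ suc) (f≤g ∘ suc))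
                                    (f>0 zero) (∏-pos (f ∘ suc) (f>0 ∘ suc)) ∏f≡∏g

squeeze : ∀ {a b c} → a ≤ b → b ≤ c → a ≡ c → a ≡ b × b ≡ c
squeeze a≤b b≤c a≡c =
  ≤-antisym a≤b (subst (_ ≤_) (sym a≡c) b≤c) , ≤-antisym b≤c (subst (_≤ _) a≡c a≤b)

≡⇔≡ : ∀ {a a′ b b′ : ℕ} → a ≡ a′ → b ≡ b′ → (a ≡ b) ⇔ (a′ ≡ b′)
≡⇔≡ refl refl = mk⇔ (λ e → e) (λ e → e)

-- Elementary inequalities for d ^ d

≤2⇒4^[d∸1]≡d^d : ∀ {d} → d ≤ 2 → 4 ^ (d ∸ 1) ≡ d ^ d
≤2⇒4^[d∸1]≡d^d z≤n             = refl
≤2⇒4^[d∸1]≡d^d (s≤s z≤n)       = refl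
≤2⇒4^[d∸1]≡d^d (s≤s (s≤s z≤n)) = refl

≥3⇒4^[d∸1]<d^d : ∀ d → 3 ≤ d → 4 ^ (d ∸ 1) < d ^ d
≥3⇒4^[d∸1]<d^d 1 (s≤s ())
≥3⇒4^[d∸1]<d^d 2 (s≤s (s≤s ()))
≥3⇒4^[d∸1]<d^d 3 _ = m≤m+n 17 10
≥3⇒4^[d∸1]<d^d (suc (suc (suc (suc d)))) _ = begin-strict
  4 ^ (3 + d)       <⟨ m<m*n (4 ^ (3 + d)) 4 {{m^n≢0 4 (3 + d)}} (s≤s (s≤s z≤n)) ⟩
  4 ^ (3 + d) * 4   ≡⟨ *-comm (4 ^ (3 + d)) 4 ⟩
  4 ^ (4 + d)       ≤⟨ ^-monoˡ-≤ (4 + d) (m≤m+n 4 d) ⟩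
  (4 + d) ^ (4 + d) ∎
  where open ≤-Reasoning

4^[d∸1]≤d^d : ∀ d → 4 ^ (d ∸ 1) ≤ d ^ d
4^[d∸1]≤d^d d with d ≤? 2
... | yes d≤2 = ≤-reflexive (≤2⇒4^[d∸1]≡d^d d≤2)
... | no  d≰2 = <⇒≤ (≥3⇒4^[d∸1]<d^d d (≰⇒> d≰2))

4^[d∸1]≡d^d⇒≤2 : ∀ d → 4 ^ (d ∸ 1) ≡ d ^ d → d ≤ 2
4^[d∸1]≡d^d⇒≤2 d eq with d ≤? 2
... | yes d≤2 = d≤2
... | no  d≰2 = contradiction eq (<⇒≢ (≥3⇒4^[d∸1]<d^d d (≰⇒> d≰2)))

≤1⇒d^d≡1 : ∀ {d} → d ≤ 1 → d ^ d ≡ 1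
≤1⇒d^d≡1 z≤n       = refl
≤1⇒d^d≡1 (s≤s z≤n) = refl

bernoulli : ∀ x c n → x ^ n * (x + suc n * c) ≤ (x + c) ^ suc n
bernoulli x c zero    = ≤-reflexive (base x c)
  where
  base : ∀ x c → 1 * (x + 1 * c) ≡ (x + c) * 1
  base = solve-∀
bernoulli x c (suc n) = begin
  x ^ suc n * (x + suc (suc n) * c)                         ≤⟨ m≤m+n _ _ ⟩
  x * x ^ n * (x + suc (suc n) * c) + x ^ n * suc n * c * c ≡⟨ expand (x ^ n) x c n ⟨
  (x + c) * (x ^ n * (x + suc n * c))                       ≤⟨ *-monoʳ-≤ (x + c) (bernoulli x c n) ⟩
  (x + c) * (x + c) ^ suc n                                 ∎
  where
  open ≤-Reasoning
  expand : ∀ p x c n → (x + c) * (p * (x + suc n * c)) ≡ x * p * (x + suc (suc n) * c) + p * suc n * c * c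
  expand = solve-∀

[1+a]^[1+a]*[1+b]≤[1+a+b]^[1+a] : ∀ a b → suc a ^ suc a * suc b ≤ suc (a + b) ^ suc a
[1+a]^[1+a]*[1+b]≤[1+a+b]^[1+a] a b = begin
  suc a ^ suc a * suc b           ≡⟨ regroup (suc a ^ a) (suc a) b ⟩
  suc a ^ a * (suc a + suc a * b) ≤⟨ bernoulli (suc a) b a ⟩
  (suc a + b) ^ suc a             ∎
  where
  open ≤-Reasoning
  regroup : ∀ p x b → x * p * suc b ≡ p * (x + x * b)
  regroup = solve-∀

d^d-merge-≤ : ∀ a b → suc a ^ suc a * suc b ^ suc b ≤ suc (a + b) ^ suc (a + b)
d^d-merge-≤ a b = begin
  suc a ^ suc a * (suc b * suc b ^ b)   ≡⟨ *-assoc (suc a ^ suc a) (suc b) _ ⟨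
  suc a ^ suc a * suc b * suc b ^ b     ≤⟨ *-mono-≤ ([1+a]^[1+a]*[1+b]≤[1+a+b]^[1+a] a b)
                                                    (^-monoˡ-≤ b (s≤s (m≤n+m b a))) ⟩
  suc (a + b) ^ suc a * suc (a + b) ^ b ≡⟨ ^-distribˡ-+-* (suc (a + b)) (suc a) b ⟨
  suc (a + b) ^ suc (a + b)             ∎
  where open ≤-Reasoning

d^d-merge-< : ∀ a b → let A = suc a; B = suc b in suc A ^ suc A * suc B ^ suc B < suc (A + B) ^ suc (A + B)
d^d-merge-< a b = begin-strict
  suc A ^ suc A * (suc B * suc B ^ B)   ≡⟨ *-assoc (suc A ^ suc A) (suc B) _ ⟨
  suc A ^ suc A * suc B * suc B ^ B     ≤⟨ *-monoˡ-≤ (suc B ^ B) ([1+a]^[1+a]*[1+b]≤[1+a+b]^[1+a] A B) ⟩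
  suc (A + B) ^ suc A * suc B ^ B       <⟨ *-monoʳ-< (suc (A + B) ^ suc A) {{m^n≢0 (suc (A + B)) (suc A)}}
                                                     (^-monoˡ-< B (s≤s (s≤s (m≤n+m B a)))) ⟩
  suc (A + B) ^ suc A * suc (A + B) ^ B ≡⟨ ^-distribˡ-+-* (suc (A + B)) (suc A) B ⟨
  suc (A + B) ^ suc (A + B)             ∎
  where
  open ≤-Reasoning
  A = suc a
  B = suc b

d^d-merge-≡⇒ : ∀ a b → suc a ^ suc a * suc b ^ suc b ≡ suc (a + b) ^ suc (a + b) → a ≡ 0 ⊎ b ≡ 0
d^d-merge-≡⇒ zero    b       _  = inj₁ refl
d^d-merge-≡⇒ (suc a) zero    _  = inj₂ refl
d^d-merge-≡⇒ (suc a) (suc b) eq = contradiction eq (<⇒≢ (d^d-merge-< a b))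

-- Degree sequences

-- 2^h d is 2 ^ h(d) for h(d) = ∑ᵢ dᵢ log dᵢ.
2^h : Vector ℕ n → ℕ
2^h d = ∏ λ i → d i ^ d i

excess : Vector ℕ n → ℕ
excess {n} d = ∑[ i < n ] (d i ∸ 1)

AtMostOne : ∀ {p} → Pred (Fin n) p → Set p
AtMostOne P = ∀ {i j} → P i → P j → i ≡ j

atMostOne-suc⁺ : ∀ {p} {P : Pred (Fin (suc n)) p} → (P zero → ∀ i → ¬ P (suc i)) →
                 AtMostOne (P ∘ suc) → AtMostOne P
atMostOne-suc⁺ excl amo {zero}  {zero}  _  _  = refl
atMostOne-suc⁺ excl amo {zero}  {suc j} P0 Pj = contradiction Pj (excl P0 j)
atMostOne-suc⁺ excl amo {suc i} {zero}  Pi P0 = contradiction Pi (excl P0 i)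
atMostOne-suc⁺ excl amo {suc i} {suc j} Pi Pj = cong suc (amo Pi Pj)

atMostOne-suc⁻ : ∀ {p} {P : Pred (Fin (suc n)) p} → AtMostOne P → AtMostOne (P ∘ suc)
atMostOne-suc⁻ amo Pi Pj = Finₚ.suc-injective (amo Pi Pj)

≤1⇒2^h≡1 : (d : Vector ℕ n) → (∀ i → d i ≤ 1) → 2^h d ≡ 1
≤1⇒2^h≡1 {n} d d≤1 = trans (∏-cong (λ i → ≤1⇒d^d≡1 (d≤1 i))) (∏-replicate-1 n)

≤1⇒excess≡0 : (d : Vector ℕ n) → (∀ i → d i ≤ 1) → excess d ≡ 0
≤1⇒excess≡0 d d≤1 = ∑-zero _ (λ i → m≤n⇒m∸n≡0 (d≤1 i))

excess≡0⇒≤1 : (d : Vector ℕ n) → excess d ≡ 0 → ∀ i → d i ≤ 1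
excess≡0⇒≤1 d excess≡0 i =
  m∸n≡0⇒m≤n (n≤0⇒n≡0 (subst (d i ∸ 1 ≤_) excess≡0 (term≤∑ (λ j → d j ∸ 1) i)))

excess≥1⇒∃≥2 : (d : Vector ℕ n) → 1 ≤ excess d → ∃ λ i → 2 ≤ d i
excess≥1⇒∃≥2 d excess≥1 =
  let (i , di∸1≥1) = ∑-pos (λ i → d i ∸ 1) excess≥1 in i , m∸n≢0⇒n<m (>⇒≢ di∸1≥1)

atMostOne⇒1+excess≡ : (d : Vector ℕ n) → AtMostOne (λ i → 2 ≤ d i) →
                      ∀ {c} → 2 ≤ d c → suc (excess d) ≡ d c
atMostOne⇒1+excess≡ d amo {c} 2≤dc = begin
  suc (excess d) ≡⟨ cong suc (∑-single (λ i → d i ∸ 1) c others) ⟩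
  1 + (d c ∸ 1)  ≡⟨ +-comm 1 (d c ∸ 1) ⟩
  d c ∸ 1 + 1    ≡⟨ m∸n+n≡m (<⇒≤ 2≤dc) ⟩
  d c            ∎
  where
  open ≡-Reasoning
  others : ∀ i → i ≢ c → d i ∸ 1 ≡ 0
  others i i≢c = m≤n⇒m∸n≡0 (≮⇒≥ (i≢c ∘ flip amo 2≤dc))

4^excess≤2^h : (d : Vector ℕ n) → 4 ^ excess d ≤ 2^h d
4^excess≤2^h d =
  subst (_≤ 2^h d) (sym (^-∑ 4 (λ i → d i ∸ 1))) (∏-mono-≤ _ _ (λ i → 4^[d∸1]≤d^d (d i)))

2^h≡4^excess⇒≤2 : (d : Vector ℕ n) → 2^h d ≡ 4 ^ excess d → ∀ i → d i ≤ 2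
2^h≡4^excess⇒≤2 d eq i = 4^[d∸1]≡d^d⇒≤2 (d i) (termwise i)
  where
  termwise : ∀ i → 4 ^ (d i ∸ 1) ≡ d i ^ d i
  termwise = ∏-mono-≤-equality _ _ (λ i → m^n>0 4 (d i ∸ 1)) (λ i → 4^[d∸1]≤d^d (d i))
                               (trans (sym (^-∑ 4 (λ i → d i ∸ 1))) (sym eq))

≤2⇒2^h≡4^excess : (d : Vector ℕ n) → (∀ i → d i ≤ 2) → 2^h d ≡ 4 ^ excess d
≤2⇒2^h≡4^excess d d≤2 =
  sym (trans (^-∑ 4 (λ i → d i ∸ 1)) (∏-cong (λ i → ≤2⇒4^[d∸1]≡d^d (d≤2 i))))

2^h≡4^excess⇔maxDegree2 : (d : Vector ℕ n) → 1 ≤ excess d →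
                          (2^h d ≡ 4 ^ excess d) ⇔ ((∀ i → d i ≤ 2) × ∃ λ i → d i ≡ 2)
2^h≡4^excess⇔maxDegree2 d excess≥1 = mk⇔ to (≤2⇒2^h≡4^excess d ∘ proj₁)
  where
  to : 2^h d ≡ 4 ^ excess d → (∀ i → d i ≤ 2) × ∃ λ i → d i ≡ 2
  to eq = let d≤2 = 2^h≡4^excess⇒≤2 d eq
              (i , 2≤di) = excess≥1⇒∃≥2 d excess≥1
          in  d≤2 , i , ≤-antisym (d≤2 i) 2≤di

2^h≤[1+excess]^[1+excess] : (d : Vector ℕ n) → 2^h d ≤ suc (excess d) ^ suc (excess d)
2^h≤[1+excess]^[1+excess] {zero}  d = ≤-refl
2^h≤[1+excess]^[1+excess] {suc n} d with d zero
... | zero  = ≤-trans (≤-reflexive (*-identityˡ _)) (2^h≤[1+excess]^[1+excess] (d ∘ suc))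
... | suc a = ≤-trans (*-monoʳ-≤ (suc a ^ suc a) (2^h≤[1+excess]^[1+excess] (d ∘ suc)))
                      (d^d-merge-≤ a (excess (d ∘ suc)))

2^h≡[1+excess]^[1+excess]⇒atMostOne : (d : Vector ℕ n) → 2^h d ≡ suc (excess d) ^ suc (excess d) →
                                      AtMostOne (λ i → 2 ≤ d i)
2^h≡[1+excess]^[1+excess]⇒atMostOne {zero}  d _  {()}
2^h≡[1+excess]^[1+excess]⇒atMostOne {suc n} d eq with d zero in d0≡
... | zero  = atMostOne-suc⁺ (λ 2≤d0 → contradiction (subst (2 ≤_) d0≡ 2≤d0) λ ())
                (2^h≡[1+excess]^[1+excess]⇒atMostOne (d ∘ suc) (trans (sym (*-identityˡ _)) eq))
... | suc a = atMostOne-suc⁺ excl (2^h≡[1+excess]^[1+excess]⇒atMostOne (d ∘ suc) tail-eq)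
  where
  S′ = excess (d ∘ suc)
  X  = suc a ^ suc a
  parts : X * 2^h (d ∘ suc) ≡ X * suc S′ ^ suc S′ × X * suc S′ ^ suc S′ ≡ suc (a + S′) ^ suc (a + S′)
  parts = squeeze (*-monoʳ-≤ X (2^h≤[1+excess]^[1+excess] (d ∘ suc))) (d^d-merge-≤ a S′) eq
  tail-eq : 2^h (d ∘ suc) ≡ suc S′ ^ suc S′
  tail-eq = *-cancelˡ-≡ _ _ X {{m^n≢0 (suc a) (suc a)}} (proj₁ parts)
  excl : 2 ≤ d zero → ∀ i → ¬ 2 ≤ d (suc i)
  excl 2≤d0 i 2≤di with d^d-merge-≡⇒ a S′ (proj₂ parts)
  ... | inj₁ refl = contradiction (subst (2 ≤_) d0≡ 2≤d0) λ { (s≤s ()) }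
  ... | inj₂ S′≡0 = <⇒≱ 2≤di (excess≡0⇒≤1 (d ∘ suc) S′≡0 i)

atMostOne⇒2^h≡[1+excess]^[1+excess] : (d : Vector ℕ n) → AtMostOne (λ i → 2 ≤ d i) →
                                      2^h d ≡ suc (excess d) ^ suc (excess d)
atMostOne⇒2^h≡[1+excess]^[1+excess] {zero}  d _   = refl
atMostOne⇒2^h≡[1+excess]^[1+excess] {suc n} d amo with d zero in d0≡
... | zero        = trans (*-identityˡ _) (atMostOne⇒2^h≡[1+excess]^[1+excess] (d ∘ suc) (atMostOne-suc⁻ amo))
... | suc zero    = trans (*-identityˡ _) (atMostOne⇒2^h≡[1+excess]^[1+excess] (d ∘ suc) (atMostOne-suc⁻ amo))
... | suc (suc a) = begin
  X * 2^h (d ∘ suc)                   ≡⟨ cong (X *_) (≤1⇒2^h≡1 (d ∘ suc) tail≤1) ⟩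
  X * 1                               ≡⟨ *-identityʳ X ⟩
  X                                   ≡⟨ cong (λ s → suc s ^ suc s) (+-identityʳ (suc a)) ⟨
  suc (suc a + 0) ^ suc (suc a + 0)   ≡⟨ cong (λ s → suc (suc a + s) ^ suc (suc a + s))
                                              (≤1⇒excess≡0 (d ∘ suc) tail≤1) ⟨
  suc (suc a + S′) ^ suc (suc a + S′) ∎
  where
  open ≡-Reasoning
  X  = suc (suc a) ^ suc (suc a)
  S′ = excess (d ∘ suc)
  tail≤1 : ∀ i → d (suc i) ≤ 1
  tail≤1 i = ≮⇒≥ λ 2≤di → Finₚ.0≢1+n (amo (subst (2 ≤_) (sym d0≡) (s≤s (s≤s z≤n))) 2≤di)

2^h≡[1+excess]^[1+excess]⇔atMostOne : (d : Vector ℕ n) →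
                                      (2^h d ≡ suc (excess d) ^ suc (excess d)) ⇔ AtMostOne (λ i → 2 ≤ d i)
2^h≡[1+excess]^[1+excess]⇔atMostOne d =
  mk⇔ (2^h≡[1+excess]^[1+excess]⇒atMostOne d) (atMostOne⇒2^h≡[1+excess]^[1+excess] d)

-- Merging the classes of a labelling

-- An idempotent labelling names each class by a root (c v ≡ v), so roots c counts the classes.
roots : (Fin n → Fin n) → ℕ
roots c = count (λ v → c v ≟ v)

module Merge {n} (c : Fin n → Fin n) (x : Fin n) (ys : List (Fin n)) where

  Touches : Pred (Fin n) _
  Touches v = Any (λ y → c v ≡ c y) (x ∷ ys)

  touches? : Decidable Touches
  touches? v = any? (λ y → c v ≟ c y) (x ∷ ys)

  merge : Fin n → Fin n
  merge v with touches? v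
  ... | yes _ = c x
  ... | no  _ = c v

  merge-touching : ∀ {v} → Touches v → merge v ≡ c x
  merge-touching {v} t with touches? v
  ... | yes _ = refl
  ... | no ¬t = contradiction t ¬t

  merge-other : ∀ {v} → ¬ Touches v → merge v ≡ c v
  merge-other {v} ¬t with touches? v
  ... | yes t = contradiction t ¬t
  ... | no _  = refl

  touches-resp : ∀ {u v} → c u ≡ c v → Touches u → Touches v
  touches-resp cu≡cv = Any.map (trans (sym cu≡cv))

  merge-resp : ∀ {u v} → c u ≡ c v → merge u ≡ merge v
  merge-resp {u} {v} cu≡cv = by-cases (touches? u)
    where
    by-cases : Dec (Touches u) → merge u ≡ merge v
    by-cases (yes t) = trans (merge-touching t) (sym (merge-touching (touches-resp cu≡cv t)))
    by-cases (no ¬t) = trans (merge-other ¬t) (trans cu≡cv (sym (merge-other (¬t ∘ touches-resp (sym cu≡cv)))))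

  merge-member : ∀ {u} → u ∈ₗ x ∷ ys → merge u ≡ c x
  merge-member u∈ = merge-touching (Any.map (cong c) u∈)

  merge-≡⁻ : ∀ {u v} → merge u ≡ merge v → c u ≡ c v ⊎ (Touches u × Touches v)
  merge-≡⁻ {u} {v} mu≡mv with touches? u | touches? v
  ... | yes tu | yes tv = inj₂ (tu , tv)
  ... | yes _  | no ¬tv = contradiction (here (sym mu≡mv)) ¬tv
  ... | no ¬tu | yes _  = contradiction (here mu≡mv) ¬tu
  ... | no _   | no _   = inj₁ mu≡mv

  module _ (idem : IdempotentFun _≡_ c) where

    merge-idem : IdempotentFun _≡_ merge
    merge-idem v with touches? v
    ... | yes _ = merge-touching (here (idem x))
    ... | no ¬t = trans (merge-other (¬t ∘ touches-resp (idem v))) (idem v)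

    image? : Decidable (_∈ₗ map c (x ∷ ys))
    image? v = v ∈ₗ? map c (x ∷ ys)

    image⇒root : ∀ {v} → v ∈ₗ map c (x ∷ ys) → c v ≡ v
    image⇒root img = let (y , _ , v≡cy) = ∈-map⁻ c img in trans (cong c v≡cy) (trans (idem y) (sym v≡cy))

    image⇒touches : ∀ {v} → v ∈ₗ map c (x ∷ ys) → Touches v
    image⇒touches img = Any.map (trans (image⇒root img)) (Anyₚ.map⁻ img)

    root-touches⇒image : ∀ {v} → c v ≡ v → Touches v → v ∈ₗ map c (x ∷ ys)
    root-touches⇒image root t = Anyₚ.map⁺ (Any.map (trans (sym root)) t)

    -- The labels of x ∷ ys are exactly the roots of c that merging destroys, except c x.
    roots-pointwise : ∀ v → 𝟙 (merge v ≟ v) + 𝟙 (image? v) ≡ 𝟙 (c v ≟ v) + 𝟙 (v ≟ c x)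
    roots-pointwise v with touches? v
    ... | no ¬t =
      cong (𝟙 (c v ≟ v) +_) (trans (𝟙-no (image? v) (¬t ∘ image⇒touches)) (sym (𝟙-no (v ≟ c x) v≢cx)))
      where
      v≢cx : v ≢ c x
      v≢cx v≡cx = ¬t (here (trans (cong c v≡cx) (idem x)))
    ... | yes t with c v ≟ v
    ...   | yes root = begin
      𝟙 (c x ≟ v) + 𝟙 (image? v) ≡⟨ cong (𝟙 (c x ≟ v) +_) (𝟙-yes (image? v) image) ⟩
      𝟙 (c x ≟ v) + 1            ≡⟨ +-comm _ 1 ⟩
      1 + 𝟙 (c x ≟ v)            ≡⟨ cong suc (𝟙-cong sym sym (c x ≟ v) (v ≟ c x)) ⟩
      1 + 𝟙 (v ≟ c x)            ∎
      where
      open ≡-Reasoning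
      image = root-touches⇒image root t
    ...   | no ¬root = begin
      𝟙 (c x ≟ v) + 𝟙 (image? v) ≡⟨ cong₂ _+_ (𝟙-no (c x ≟ v) cx≢v) (𝟙-no (image? v) not-image) ⟩
      0                          ≡⟨ 𝟙-no (v ≟ c x) (cx≢v ∘ sym) ⟨
      𝟙 (v ≟ c x)                ∎
      where
      open ≡-Reasoning
      cx≢v : c x ≢ v
      cx≢v cx≡v = ¬root (trans (cong c (sym cx≡v)) (trans (idem x) cx≡v))
      not-image = ¬root ∘ image⇒root

    roots-merge : Unique (map c (x ∷ ys)) → roots merge + length ys ≡ roots c
    roots-merge uniq = suc-injective (begin
      suc (roots merge + length ys)                ≡⟨ +-suc _ _ ⟨
      roots merge + length (x ∷ ys)                ≡⟨ cong (roots merge +_) (length-map c (x ∷ ys)) ⟨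
      roots merge + length (map c (x ∷ ys))        ≡⟨ cong (roots merge +_) (count-∈ _ uniq) ⟨
      roots merge + count image?                   ≡⟨ ∑-distrib-+ (𝟙 ∘ λ v → merge v ≟ v) (𝟙 ∘ image?) ⟨
      ∑[ v < n ] (𝟙 (merge v ≟ v) + 𝟙 (image? v)) ≡⟨ sum-cong-≗ roots-pointwise ⟩
      ∑[ v < n ] (𝟙 (c v ≟ v) + 𝟙 (v ≟ c x))      ≡⟨ ∑-distrib-+ (𝟙 ∘ λ v → c v ≟ v) (𝟙 ∘ (_≟ c x)) ⟩
      roots c + count (_≟ c x)                     ≡⟨ cong (roots c +_) (count-≡ (c x)) ⟩
      roots c + 1                                  ≡⟨ +-comm _ 1 ⟩
      suc (roots c)                                ∎)
      where open ≡-Reasoning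

∣p∣≡count : (p : Subset n) → ∣ p ∣ ≡ count (_∈? p)
∣p∣≡count []            = refl
∣p∣≡count (inside ∷ p)  = cong suc (∣p∣≡count p)
∣p∣≡count (outside ∷ p) = ∣p∣≡count p

elements : Subset n → List (Fin n)
elements p = filter (_∈? p) (allFin _)

∈-elements⁺ : ∀ {p : Subset n} {v} → v ∈ p → v ∈ₗ elements p
∈-elements⁺ {v = v} v∈p = ∈-filter⁺ (_∈? _) (∈-allFin v) v∈p

∈-elements⁻ : ∀ {p : Subset n} {v} → v ∈ₗ elements p → v ∈ p
∈-elements⁻ {p = p} v∈ = proj₂ (∈-filter⁻ (_∈? p) {xs = allFin _} v∈)

elements-unique : (p : Subset n) → Unique (elements p)
elements-unique {n} p = Uniqueₚ.filter⁺ (_∈? p) (Uniqueₚ.allFin⁺ n)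

length-elements : (p : Subset n) → length (elements p) ≡ ∣ p ∣
length-elements p = trans (length-filter-tabulate (_∈? p) (λ v → v)) (sym (∣p∣≡count p))

module _ (H : Hypergraph) where

  expH≡2^h : expH H ≡ 2^h (deg H)
  expH≡2^h = product-allFin (λ v → deg H v ^ deg H v)

  deg≡count : ∀ v → deg H v ≡ count (λ i → v ∈? edge H i)
  deg≡count v = trans (cong (length ∘ filter (v ∈?_)) (sym (tabulate-lookup (edges H))))
                      (length-filter-tabulate (v ∈?_) (edge H))

  ∣edge∣≡k : ∀ {k} → Uniform k H → ∀ i → ∣ edge H i ∣ ≡ k
  ∣edge∣≡k uniform i = All.lookup uniform (∈-lookup i)

  ∑deg≡#E*k : ∀ {k} → Uniform k H → ∑[ v < #V H ] deg H v ≡ #E H * k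
  ∑deg≡#E*k {k} uniform = begin
    ∑[ v < #V H ] deg H v                         ≡⟨ sum-cong-≗ deg≡count ⟩
    ∑[ v < #V H ] ∑[ i < #E H ] 𝟙 (v ∈? edge H i) ≡⟨ ∑-comm (λ v i → 𝟙 (v ∈? edge H i)) ⟩
    ∑[ i < #E H ] ∑[ v < #V H ] 𝟙 (v ∈? edge H i) ≡⟨ sum-cong-≗ (∣p∣≡count ∘ edge H) ⟨
    ∑[ i < #E H ] ∣ edge H i ∣                     ≡⟨ sum-cong-≗ (∣edge∣≡k uniform) ⟩
    ∑[ i < #E H ] k                                ≡⟨ ∑-const (#E H) k ⟩
    #E H * k                                       ∎
    where open ≡-Reasoning

  edge-member : ∀ {k} → Uniform k H → 1 ≤ k → (i : Fin (#E H)) → ∃ λ v → v ∈ edge H i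
  edge-member uniform k≥1 i =
    count≥1⇒∃ (_∈? edge H i)
              (subst (1 ≤_) (trans (sym (∣edge∣≡k uniform i)) (∣p∣≡count (edge H i))) k≥1)

  hyperstar⇒atMostOne : IsHyperstar H → AtMostOne (λ v → 2 ≤ deg H v)
  hyperstar⇒atMostOne (c , _ , disjoint) 2≤du 2≤dv = trans (centre 2≤du) (sym (centre 2≤dv))
    where
    centre : ∀ {v} → 2 ≤ deg H v → v ≡ c
    centre {v} 2≤dv =
      let (i , j , i≢j , v∈i , v∈j) =
            count≥2⇒∃₂ (λ i → v ∈? edge H i) (subst (2 ≤_) (deg≡count v) 2≤dv)
      in  disjoint i j i≢j v v∈i v∈j

  atMostOne⇒hyperstar : AtMostOne (λ v → 2 ≤ deg H v) →
                        ∀ {c} → 2 ≤ deg H c → deg H c ≡ #E H → IsHyperstar H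
  atMostOne⇒hyperstar amo {c} 2≤dc dc≡m =
    c , count≡n⇒all (λ i → c ∈? edge H i) (trans (sym (deg≡count c)) dc≡m) , disjoint
    where
    disjoint : ∀ i j → i ≢ j → ∀ v → v ∈ edge H i → v ∈ edge H j → v ≡ c
    disjoint i j i≢j v v∈i v∈j =
      amo (subst (2 ≤_) (sym (deg≡count v)) (count≥2 (λ i → v ∈? edge H i) i≢j v∈i v∈j)) 2≤dc

  atMostOne⇔hyperstar : 1 ≤ excess (deg H) → suc (excess (deg H)) ≡ #E H →
                        AtMostOne (λ v → 2 ≤ deg H v) ⇔ IsHyperstar H
  atMostOne⇔hyperstar excess≥1 1+excess≡m = mk⇔ to hyperstar⇒atMostOne
    where
    to : AtMostOne (λ v → 2 ≤ deg H v) → IsHyperstar H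
    to amo = let (c , 2≤dc) = excess≥1⇒∃≥2 (deg H) excess≥1 in
             atMostOne⇒hyperstar amo 2≤dc (trans (sym (atMostOne⇒1+excess≡ (deg H) amo 2≤dc)) 1+excess≡m)

-- Walks, paths and cycles

module Walks (H : Hypergraph) where

  Vertex = Fin (#V H)
  EdgeIx = Fin (#E H)

  infix  4 _⇝_
  infixr 5 _++ᵂ_

  data _⇝_ : Vertex → Vertex → Set where
    []   : ∀ {u} → u ⇝ u
    step : ∀ {u w} (j : EdgeIx) (v : Vertex) → u ∈ edge H j → v ∈ edge H j → v ⇝ w → u ⇝ w

  private
    variable
      u v w x : Vertex
      j : EdgeIx

  vertices : u ⇝ w → List Vertex
  vertices {u} []               = u ∷ []
  vertices {u} (step _ _ _ _ p) = u ∷ vertices p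

  edgesOf : u ⇝ w → List EdgeIx
  edgesOf []               = []
  edgesOf (step j _ _ _ p) = j ∷ edgesOf p

  IsPath : u ⇝ w → Set
  IsPath []                   = ⊤
  IsPath {u} (step j _ _ _ p) = u ∉ₗ vertices p × j ∉ₗ edgesOf p × IsPath p

  _++ᵂ_ : u ⇝ v → v ⇝ w → u ⇝ w
  []                 ++ᵂ q = q
  step j v u∈j v∈j p ++ᵂ q = step j v u∈j v∈j (p ++ᵂ q)

  edgesOf-++ : (p : u ⇝ v) (q : v ⇝ w) → edgesOf (p ++ᵂ q) ≡ edgesOf p ++ edgesOf q
  edgesOf-++ []               q = refl
  edgesOf-++ (step j _ _ _ p) q = cong (j ∷_) (edgesOf-++ p q)

  first-edge : u ⇝ v → u ≢ v → ∃ λ j → u ∈ edge H j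
  first-edge []                 u≢u = contradiction refl u≢u
  first-edge (step j _ u∈j _ _) _   = j , u∈j

  suffix-from-vertex : (p : u ⇝ w) → IsPath p → x ∈ₗ vertices p →
                       Σ (x ⇝ w) λ q → IsPath q × vertices q ⊆ vertices p × edgesOf q ⊆ edgesOf p
  suffix-from-vertex []                 _                (here refl) = [] , tt , ⊆-refl , ⊆-refl
  suffix-from-vertex p@(step _ _ _ _ _) path-p           (here refl) = p , path-p , ⊆-refl , ⊆-refl
  suffix-from-vertex (step j v _ _ p)   (_ , _ , path-p) (there x∈p) =
    let (q , path-q , vq⊆vp , eq⊆ep) = suffix-from-vertex p path-p x∈p
    in  q , path-q , ⊆-trans vq⊆vp (xs⊆x∷xs _ _) , ⊆-trans eq⊆ep (xs⊆x∷xs _ j)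

  suffix-after-edge : (p : u ⇝ w) → IsPath p → j ∈ₗ edgesOf p →
                      Σ Vertex λ b → b ∈ edge H j × Σ (b ⇝ w) λ q →
                        IsPath q × j ∉ₗ edgesOf q × vertices q ⊆ vertices p × edgesOf q ⊆ edgesOf p
  suffix-after-edge (step j v _ v∈j p) (_ , j∉p , path-p) (here refl) =
    v , v∈j , p , path-p , j∉p , xs⊆x∷xs _ _ , xs⊆x∷xs _ j
  suffix-after-edge (step j v _ _ p)   (_ , _ , path-p)   (there j∈p) =
    let (b , b∈j , q , path-q , j∉q , vq⊆vp , eq⊆ep) = suffix-after-edge p path-p j∈p
    in  b , b∈j , q , path-q , j∉q , ⊆-trans vq⊆vp (xs⊆x∷xs _ _) , ⊆-trans eq⊆ep (xs⊆x∷xs _ j)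

  -- Make the rest of the walk a path q.  If q passes through u again, keep q from there on;
  -- if q uses the edge j again, go through j directly to the vertex where q leaves it.
  walk⇒path : (p : u ⇝ w) → Σ (u ⇝ w) λ q → IsPath q × edgesOf q ⊆ edgesOf p
  walk⇒path [] = [] , tt , ⊆-refl
  walk⇒path {u} (step j v u∈j v∈j p) with walk⇒path p
  ... | q , path-q , eq⊆ep with u ∈ₗ? vertices q
  ...   | yes u∈q =
    let (r , path-r , _ , er⊆eq) = suffix-from-vertex q path-q u∈q
    in  r , path-r , ⊆-trans er⊆eq (⊆-trans eq⊆ep (xs⊆x∷xs _ j))
  ...   | no u∉q with j ∈ₗ? edgesOf q
  ...     | yes j∈q =
    let (b , b∈j , r , path-r , j∉r , vr⊆vq , er⊆eq) = suffix-after-edge q path-q j∈q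
    in  step j b u∈j b∈j r , (u∉q ∘ vr⊆vq , j∉r , path-r) , ∷⁺ʳ j (⊆-trans er⊆eq eq⊆ep)
  ...     | no j∉q = step j v u∈j v∈j q , (u∉q , j∉q , path-q) , ∷⁺ʳ j eq⊆ep

  steps : u ⇝ w → ℕ
  steps []               = 0
  steps (step _ _ _ _ p) = suc (steps p)

  vertexAt : (p : u ⇝ w) → Fin (suc (steps p)) → Vertex
  vertexAt {u} []               _       = u
  vertexAt {u} (step _ _ _ _ p) zero    = u
  vertexAt     (step _ _ _ _ p) (suc t) = vertexAt p t

  edgeAt : (p : u ⇝ w) → Fin (steps p) → EdgeIx
  edgeAt (step j _ _ _ p) zero    = j
  edgeAt (step _ _ _ _ p) (suc t) = edgeAt p t

  vertexAt-first : (p : u ⇝ w) → vertexAt p zero ≡ u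
  vertexAt-first []               = refl
  vertexAt-first (step _ _ _ _ _) = refl

  vertexAt-last : (p : u ⇝ w) → vertexAt p (fromℕ (steps p)) ≡ w
  vertexAt-last []               = refl
  vertexAt-last (step _ _ _ _ p) = vertexAt-last p

  incident : (p : u ⇝ w) (t : Fin (steps p)) →
             vertexAt p (inject₁ t) ∈ edge H (edgeAt p t) × vertexAt p (suc t) ∈ edge H (edgeAt p t)
  incident (step j v u∈j v∈j p) zero    = u∈j , subst (_∈ edge H j) (sym (vertexAt-first p)) v∈j
  incident (step _ _ _ _ p)     (suc t) = incident p t

  toWalk : u ⇝ w → Walk H
  toWalk p = record { len = steps p ; vs = vertexAt p ; es = edgeAt p ; ok = incident p }

  fromWalk : (W : Walk H) → start W ⇝ end W
  fromWalk W = go (len W) (vs W) (es W) (ok W)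
    where
    go : ∀ l (f : Fin (suc l) → Vertex) (g : Fin l → EdgeIx) →
         (∀ t → f (inject₁ t) ∈ edge H (g t) × f (suc t) ∈ edge H (g t)) → f zero ⇝ f (fromℕ l)
    go zero    f g inc = []
    go (suc l) f g inc = step (g zero) (f (suc zero)) (proj₁ (inc zero)) (proj₂ (inc zero))
                              (go l (f ∘ suc) (g ∘ suc) (inc ∘ suc))

  close : ∀ {u v x j} → u ⇝ v → v ∈ edge H j → x ∈ edge H j → u ⇝ x
  close {x = x} {j = j} q v∈j x∈j = q ++ᵂ step j x v∈j x∈j []

  module _ {x v j} (v∈j : v ∈ edge H j) (x∈j : x ∈ edge H j) where

    steps-close : (q : u ⇝ v) → steps (close q v∈j x∈j) ≡ suc (steps q)
    steps-close []               = refl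
    steps-close (step _ _ _ _ q) = cong suc (steps-close q)

    close-vertex∈ : (q : u ⇝ v) (t : Fin (steps (close q v∈j x∈j))) →
                    vertexAt (close q v∈j x∈j) (inject₁ t) ∈ₗ vertices q
    close-vertex∈ []               zero    = here refl
    close-vertex∈ (step _ _ _ _ q) zero    = here refl
    close-vertex∈ (step _ _ _ _ q) (suc t) = there (close-vertex∈ q t)

    close-edge∈ : (q : u ⇝ v) (t : Fin (steps (close q v∈j x∈j))) →
                  edgeAt (close q v∈j x∈j) t ∈ₗ j ∷ edgesOf q
    close-edge∈ []               zero    = here refl
    close-edge∈ (step _ _ _ _ q) zero    = there (here refl)
    close-edge∈ (step _ _ _ _ q) (suc t) with close-edge∈ q t
    ... | here  e≡j = here e≡j
    ... | there e∈q = there (there e∈q)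

    close-vertexAt-injective : (q : u ⇝ v) → IsPath q →
                               Injective _≡_ _≡_ (λ t → vertexAt (close q v∈j x∈j) (inject₁ t))
    close-vertexAt-injective []               _                {zero}  {zero}  _ = refl
    close-vertexAt-injective (step _ _ _ _ q) _                {zero}  {zero}  _ = refl
    close-vertexAt-injective (step _ _ _ _ q) (u∉q , _ , _)    {zero}  {suc t} e =
      contradiction (subst (_∈ₗ vertices q) (sym e) (close-vertex∈ q t)) u∉q
    close-vertexAt-injective (step _ _ _ _ q) (u∉q , _ , _)    {suc s} {zero}  e =
      contradiction (subst (_∈ₗ vertices q) e (close-vertex∈ q s)) u∉q
    close-vertexAt-injective (step _ _ _ _ q) (_ , _ , path-q) {suc s} {suc t} e =
      cong suc (close-vertexAt-injective q path-q e)

    close-edgeAt-injective : (q : u ⇝ v) → IsPath q → j ∉ₗ edgesOf q →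
                             Injective _≡_ _≡_ (edgeAt (close q v∈j x∈j))
    close-edgeAt-injective []               _                _   {zero}  {zero}  _ = refl
    close-edgeAt-injective (step _ _ _ _ q) _                _   {zero}  {zero}  _ = refl
    close-edgeAt-injective (step i _ _ _ q) (_ , i∉q , _)    j∉  {zero}  {suc t} e =
      contradiction (subst (_∈ₗ j ∷ edgesOf q) (sym e) (close-edge∈ q t)) (∉-swap i∉q j∉)
    close-edgeAt-injective (step i _ _ _ q) (_ , i∉q , _)    j∉  {suc s} {zero}  e =
      contradiction (subst (_∈ₗ j ∷ edgesOf q) e (close-edge∈ q s)) (∉-swap i∉q j∉)
    close-edgeAt-injective (step _ _ _ _ q) (_ , _ , path-q) j∉  {suc s} {suc t} e =
      cong suc (close-edgeAt-injective q path-q (j∉ ∘ there) e)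

    close-isCycle : (q : x ⇝ v) → IsPath q → j ∉ₗ edgesOf q → x ≢ v →
                    IsCycle (toWalk (close q v∈j x∈j))
    close-isCycle q path-q j∉q x≢v =
      subst (2 ≤_) (sym (steps-close q)) (s≤s (nonempty q x≢v)) ,
      trans (vertexAt-first (close q v∈j x∈j)) (sym (vertexAt-last (close q v∈j x∈j))) ,
      close-vertexAt-injective q path-q ,
      close-edgeAt-injective q path-q j∉q
      where
      nonempty : (q : x ⇝ v) → x ≢ v → 1 ≤ steps q
      nonempty []               x≢x = contradiction refl x≢x
      nonempty (step _ _ _ _ _) _   = s≤s z≤n

other-than : 2 ≤ n → (v : Fin n) → ∃ λ u → u ≢ v
other-than {suc zero}    (s≤s ()) _
other-than {suc (suc _)} _        v = punchIn v zero , punchInᵢ≢i v zero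

connected⇒deg≥1 : (H : Hypergraph) → Connected H → 2 ≤ #V H → ∀ v → 1 ≤ deg H v
connected⇒deg≥1 H connected n≥2 v =
  let (u , u≢v) = other-than n≥2 v
      (W , start≡v , end≡u) = connected v u
      (j , start∈j) = first-edge (fromWalk W) (λ s≡e → u≢v (trans (sym end≡u) (trans (sym s≡e) start≡v)))
  in  subst (1 ≤_) (sym (deg≡count H v))
            (count≥1 (λ i → v ∈? edge H i) (subst (_∈ edge H j) start≡v start∈j))
  where open Walks H

-- The order of a supertree

module ComponentLabelling (H : Hypergraph) {k} (uniform : Uniform k H) (k≥1 : 1 ≤ k) (acyclic : Acyclic H) where

  open Walks H

  Below : ℕ → List EdgeIx → Set
  Below i = All (λ j → toℕ j < i)

  -- The components of the sub-hypergraph formed by the edges with index below i.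
  record Labelling (i : ℕ) : Set where
    field
      label   : Vertex → Vertex
      idem    : IdempotentFun _≡_ label
      joined  : ∀ {u v} → label u ≡ label v → Σ (u ⇝ v) λ p → Below i (edgesOf p)
      merged  : ∀ j → toℕ j < i → ∀ {u v} → u ∈ edge H j → v ∈ edge H j → label u ≡ label v
      counted : roots label + i * (k ∸ 1) ≡ #V H

  initial : Labelling 0
  initial = record
    { label   = λ v → v
    ; idem    = λ _ → refl
    ; joined  = λ { refl → [] , [] }
    ; merged  = λ _ ()
    ; counted = trans (+-identityʳ _) (count-full (λ v → v ≟ v) (λ _ → refl))
    }

  module Extend {i} (ℓ : Labelling i) (e : EdgeIx) (e≡i : toℕ e ≡ i)
                (x : Vertex) (ys : List Vertex) (members : ∀ {v} → (v ∈ₗ x ∷ ys) ⇔ (v ∈ edge H e))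
                (uniq : Unique (x ∷ ys)) (size : length ys ≡ k ∸ 1) where

    open Labelling ℓ
    open Merge label x ys

    in-edge : ∀ {v} → v ∈ₗ x ∷ ys → v ∈ edge H e
    in-edge = Equivalence.to members

    in-list : ∀ {v} → v ∈ edge H e → v ∈ₗ x ∷ ys
    in-list = Equivalence.from members

    below-suc : ∀ {js} → Below i js → Below (suc i) js
    below-suc = All.map m≤n⇒m≤1+n

    -- Two vertices of e in one component would be joined by a path avoiding e, closing a cycle.
    labels-distinct : ∀ {a b} → a ∈ edge H e → b ∈ edge H e → label a ≡ label b → a ≡ b
    labels-distinct {a} {b} a∈e b∈e la≡lb with a ≟ b
    ... | yes a≡b = a≡b
    ... | no  a≢b =
      let (p , p-below) = joined la≡lb
          (q , path-q , eq⊆ep) = walk⇒path p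
          e∉q = λ e∈q → <-irrefl e≡i (All.lookup p-below (eq⊆ep e∈q))
      in  ⊥-elim (acyclic (toWalk (close q b∈e a∈e)) (close-isCycle b∈e a∈e q path-q e∉q a≢b))

    labels-unique : Unique (map label (x ∷ ys))
    labels-unique = Unique-map⁺ label (λ a∈ b∈ → labels-distinct (in-edge a∈) (in-edge b∈)) uniq

    joined′ : ∀ {u v} → merge u ≡ merge v → Σ (u ⇝ v) λ p → Below (suc i) (edgesOf p)
    joined′ mu≡mv with merge-≡⁻ mu≡mv
    ... | inj₁ lu≡lv = let (p , p-below) = joined lu≡lv in p , below-suc p-below
    ... | inj₂ (tu , tv) =
      let (a , a∈ , lu≡la) = find tu
          (b , b∈ , lv≡lb) = find tv
          (p , p-below) = joined lu≡la
          (q , q-below) = joined (sym lv≡lb)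
      in  p ++ᵂ step e b (in-edge a∈) (in-edge b∈) q ,
          subst (Below (suc i)) (sym (edgesOf-++ p _))
                (Allₚ.++⁺ (below-suc p-below) (≤-reflexive (cong suc e≡i) ∷ below-suc q-below))

    merged′ : ∀ j → toℕ j < suc i → ∀ {u v} → u ∈ edge H j → v ∈ edge H j → merge u ≡ merge v
    merged′ j j<1+i u∈j v∈j with m≤n⇒m<n∨m≡n (s≤s⁻¹ j<1+i)
    ... | inj₁ j<i = merge-resp (merged j j<i u∈j v∈j)
    ... | inj₂ j≡i with Finₚ.toℕ-injective (trans j≡i (sym e≡i))
    ...   | refl = trans (merge-member (in-list u∈j)) (sym (merge-member (in-list v∈j)))

    counted′ : roots merge + suc i * (k ∸ 1) ≡ #V H
    counted′ = begin
      roots merge + (k ∸ 1 + i * (k ∸ 1))   ≡⟨ +-assoc (roots merge) (k ∸ 1) _ ⟨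
      roots merge + (k ∸ 1) + i * (k ∸ 1)   ≡⟨ cong (λ s → roots merge + s + i * (k ∸ 1)) size ⟨
      roots merge + length ys + i * (k ∸ 1) ≡⟨ cong (_+ i * (k ∸ 1)) (roots-merge idem labels-unique) ⟩
      roots label + i * (k ∸ 1)             ≡⟨ counted ⟩
      #V H                                  ∎
      where open ≡-Reasoning

    next : Labelling (suc i)
    next = record
      { label = merge ; idem = merge-idem idem ; joined = joined′ ; merged = merged′ ; counted = counted′ }

  extend : ∀ {i} → Labelling i → (e : EdgeIx) → toℕ e ≡ i → Labelling (suc i)
  extend {i} ℓ e e≡i = from-list (elements (edge H e)) (mk⇔ ∈-elements⁻ ∈-elements⁺)
                                 (elements-unique (edge H e))
                                 (trans (length-elements (edge H e)) (∣edge∣≡k H uniform e))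
    where
    from-list : (L : List Vertex) → (∀ {v} → (v ∈ₗ L) ⇔ (v ∈ edge H e)) → Unique L → length L ≡ k →
                Labelling (suc i)
    from-list []       _       _    0≡k = contradiction 0≡k (<⇒≢ k≥1)
    from-list (x ∷ ys) members uniq len = Extend.next ℓ e e≡i x ys members uniq (cong (_∸ 1) len)

  labelling : ∀ i → i ≤ #E H → Labelling i
  labelling zero    _   = initial
  labelling (suc i) i<m = extend (labelling i (<⇒≤ i<m)) (fromℕ< i<m) (Finₚ.toℕ-fromℕ< i<m)

  open Labelling (labelling (#E H) ≤-refl)

  label-along : ∀ {u v} → u ⇝ v → label u ≡ label v
  label-along []                   = refl
  label-along (step j _ u∈j w∈j p) = trans (merged j (Finₚ.toℕ<n j) u∈j w∈j) (label-along p)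

  connected⇒roots≡1 : Connected H → Vertex → roots label ≡ 1
  connected⇒roots≡1 connected v₀ = trans (∑-single _ r not-root) (𝟙-yes (label r ≟ r) (idem v₀))
    where
    r = label v₀
    label≡r : ∀ v → label v ≡ r
    label≡r v = let (W , start≡v , end≡v₀) = connected v v₀ in
                subst₂ (λ a b → label a ≡ label b) start≡v end≡v₀ (label-along (fromWalk W))
    not-root : ∀ v → v ≢ r → 𝟙 (label v ≟ v) ≡ 0
    not-root v v≢r = 𝟙-no (label v ≟ v) (λ lv≡v → v≢r (trans (sym lv≡v) (label≡r v)))

  order : Connected H → Vertex → #V H ≡ 1 + #E H * (k ∸ 1)
  order connected v₀ = trans (sym counted) (cong (_+ #E H * (k ∸ 1)) (connected⇒roots≡1 connected v₀))

supertree-order : ∀ {k} (H : Hypergraph) → Uniform k H → 1 ≤ k → IsSupertree H → Fin (#V H) →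
                  #V H ≡ 1 + #E H * (k ∸ 1)
supertree-order H uniform k≥1 (connected , acyclic) = ComponentLabelling.order H uniform k≥1 acyclic connected

supertree-1+excess≡#E : ∀ {k} (H : Hypergraph) → Uniform k H → 2 ≤ k → IsSupertree H → 1 ≤ #E H →
                        suc (excess (deg H)) ≡ #E H
supertree-1+excess≡#E {k} H uniform k≥2 supertree m≥1 = cancel (excess (deg H)) k≥1 (begin
  excess (deg H) + (1 + #E H * (k ∸ 1)) ≡⟨ cong (excess (deg H) +_) order ⟨
  excess (deg H) + #V H                 ≡⟨ ∑-pred (deg H) (connected⇒deg≥1 H (proj₁ supertree) n≥2) ⟩
  ∑[ v < #V H ] deg H v                 ≡⟨ ∑deg≡#E*k H uniform ⟩
  #E H * k                              ∎)
  where
  open ≡-Reasoning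
  k≥1 = <⇒≤ k≥2
  order : #V H ≡ 1 + #E H * (k ∸ 1)
  order = supertree-order H uniform k≥1 supertree (proj₁ (edge-member H uniform k≥1 (fromℕ< m≥1)))
  n≥2 : 2 ≤ #V H
  n≥2 = subst (2 ≤_) (sym order) (s≤s (*-mono-≤ m≥1 (∸-monoˡ-≤ 1 k≥2)))
  cancel : ∀ s {k m} → 1 ≤ k → s + (1 + m * (k ∸ 1)) ≡ m * k → suc s ≡ m
  cancel s {suc k} {m} _ eq = +-cancelʳ-≡ (m * k) (suc s) m (trans (sym (+-suc s (m * k))) (trans eq (*-suc m k)))

lemma4 : ∀ (k m : ℕ) → 3 ≤ k → 2 ≤ m → (T : Hypergraph) → Uniform k T → IsSupertree T → #E T ≡ m →
           ((2 ^ (2 * (m ∸ 1)) ≤ expH T) × ((expH T ≡ 2 ^ (2 * (m ∸ 1))) ⇔ MaxDegreeIs T 2))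
         × ((expH T ≤ m ^ m) × ((expH T ≡ m ^ m) ⇔ IsHyperstar T))
lemma4 k .(#E T) k≥3 m≥2 T uniform supertree refl =
  (subst₂ _≤_ 4^S≡ (sym (expH≡2^h T)) (4^excess≤2^h d) ,
   ⇔-trans (≡⇔≡ (expH≡2^h T) (sym 4^S≡)) (2^h≡4^excess⇔maxDegree2 d S≥1)) ,
  (subst₂ _≤_ (sym (expH≡2^h T)) [1+S]^[1+S]≡ (2^h≤[1+excess]^[1+excess] d) ,
   ⇔-trans (≡⇔≡ (expH≡2^h T) (sym [1+S]^[1+S]≡))
           (⇔-trans (2^h≡[1+excess]^[1+excess]⇔atMostOne d) (atMostOne⇔hyperstar T S≥1 1+S≡m)))
  where
  d = deg T
  S = excess d
  1+S≡m : suc S ≡ #E T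
  1+S≡m = supertree-1+excess≡#E T uniform (<⇒≤ k≥3) supertree (<⇒≤ m≥2)
  S≥1 : 1 ≤ S
  S≥1 = s≤s⁻¹ (subst (2 ≤_) (sym 1+S≡m) m≥2)
  4^S≡ : 4 ^ S ≡ 2 ^ (2 * (#E T ∸ 1))
  4^S≡ = trans (^-*-assoc 2 2 S) (cong (λ s → 2 ^ (2 * (s ∸ 1))) 1+S≡m)
  [1+S]^[1+S]≡ : suc S ^ suc S ≡ #E T ^ #E T
  [1+S]^[1+S]≡ = cong (λ s → s ^ s) 1+S≡m
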